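{- Let $\widetilde{\Sigma}$ be a $K$-stack call-return alphabet. For every generalized Büchi MNWA $\mathcal{B}$ over $\widetilde{\Sigma}$ there is a Büchi MNWA $\mathcal{B}'$ over $\widetilde{\Sigma}$ such that $\mathcal{L}^\omega(\mathcal{B}')=\mathcal{L}^\omega(\mathcal{B})$.
   Context: Let $\mathbb{N}_+=\{1,2,\dots\}$, $[K]=\{1,\dots,K\}$. A $K$-stack call-return alphabet is $\widetilde{\Sigma}=\langle\{(\Sigma_c^s,\Sigma_r^s)\}_{s\in[K]},\Sigma_{int}\rangle$ of pairwise disjoint finite sets; $\Sigma_c=\bigcup_s\Sigma_c^s$, $\Sigma_r=\bigcup_s\Sigma_r^s$, $\Sigma=\Sigma_c\cup\Sigma_r\cup\Sigma_{int}$. A string is $s$-well formed if generated by $A::=aAb\mid AA\mid\varepsilon\mid c$, $a\in\Sigma_c^s$, $b\in\Sigma_r^s$, $c\in\Sigma\setminus(\Sigma_c^s\cup\Sigma_r^s)$. An infinite nested word is $(\mathbb{N}_+,\lessdot,\mu,\lambda)$ with $\lessdot=\{(i,i+1)\mid i\in\mathbb{N}_+\}$, $\lambda:\mathbb{N}_+\to\Sigma$, $\mu=\bigcup_s\mu^s$ with $(i,j)\in\mu^s$ iff $i<j$, $\lambda(i)\in\Sigma_c^s$, $\lambda(j)\in\Sigma_r^s$, $\lambda(i+1)\dots\lambda(j-1)$ $s$-well formed. $\mu(i)=j$, $\mu^{ -1}(j)=i$ for $(i,j)\in\mu$. A generalized Büchi MNWA over $\widetilde{\Sigma}$ is $\mathcal{B}=(Q,\delta,Q_I,F,C)$,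 finite $Q$, $Q_I,F,C\subseteq Q$, $\delta=\langle\delta_1,\delta_2\rangle$, $\delta_1\subseteq Q\times\Sigma\times Q$, $\delta_2\subseteq Q\times Q\times\Sigma_r\times Q$; it is a Büchi MNWA if $C=\emptyset$. A run on an infinite nested word $(\mathbb{N}_+,\lessdot,\mu,\lambda)$ is $\rho:\mathbb{N}_+\to Q$ with $(q,\lambda(1),\rho(1))\in\delta_1$ for some $q\in Q_I$ and for $i\ge2$: $(\rho(\mu^{ -1}(i)),\rho(i-1),\lambda(i),\rho(i))\in\delta_2$ if $\lambda(i)\in\Sigma_r$ and $\mu^{ -1}(i)$ is defined, else $(\rho(i-1),\lambda(i),\rho(i))\in\delta_1$. It is accepting if $\rho(i)\in F$ for infinitely many $i$ and, for every $i$ with $\rho(i)\in C$, $\lambda(i)\in\Sigma_c$ and $\mu(i)$ is defined. $\mathcal{L}^\omega(\mathcal{B})$ is the set of infinite nested words with an accepting run. -}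

module Defs where

open import Data.Nat using (ℕ; zero; suc; _+_; _∸_; _<_; _≤_)
open import Data.Fin using (Fin)
open import Data.Bool using (Bool; T; false)
open import Data.List using (List; []; _∷_; _++_; [_]; applyUpTo)
open import Data.Product using (Σ; ∃; _×_; _,_)
open import Data.Empty using (⊥)
open import Relation.Nullary using (¬_)
open import Relation.Binary.PropositionalEquality using (_≡_)

data Kind (K : ℕ) : Set where
  call : Fin K → Kind K
  ret  : Fin K → Kind K
  int  : Kind K

-- A K-stack call-return alphabet: a finite set of letters Fin size, each
-- classified into exactly one of Σ_c^s, Σ_r^s (s ∈ [K]) or Σ_int
-- (pairwise disjointness is automatic from the classification).
record Alphabet : Set where
  field
    K    : ℕ
    size : ℕ
    kind : Fin size → Kind K

module _ (A : Alphabet) where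
  open Alphabet A

  Letter : Set
  Letter = Fin size

  IsCallOf : Fin K → Letter → Set
  IsCallOf s a = kind a ≡ call s

  IsRetOf : Fin K → Letter → Set
  IsRetOf s b = kind b ≡ ret s

  IsCall : Letter → Set
  IsCall a = ∃ λ s → IsCallOf s a

  IsRet : Letter → Set
  IsRet b = ∃ λ s → IsRetOf s b

  data WellFormed (s : Fin K) : List Letter → Set where
    wf-nest : ∀ {a b x} → IsCallOf s a → IsRetOf s b → WellFormed s x →
              WellFormed s (a ∷ x ++ [ b ])
    wf-cat  : ∀ {x y} → WellFormed s x → WellFormed s y → WellFormed s (x ++ y)
    wf-eps  : WellFormed s []
    wf-let  : ∀ {c} → ¬ IsCallOf s c → ¬ IsRetOf s c → WellFormed s [ c ]

  -- An infinite word; position p ∈ ℕ₊ of the paper is index p ∸ 1 here.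
  Word : Set
  Word = ℕ → Letter

  segment : Word → ℕ → ℕ → List Letter
  segment w i j = applyUpTo (λ k → w (suc i + k)) (j ∸ suc i)

  MatchOf : Fin K → Word → ℕ → ℕ → Set
  MatchOf s w i j = i < j × IsCallOf s (w i) × IsRetOf s (w j) ×
                    WellFormed s (segment w i j)

  Match : Word → ℕ → ℕ → Set
  Match w i j = ∃ λ s → MatchOf s w i j

  record GMNWA : Set where
    field
      states : ℕ
      δ₁ : Fin states → Letter → Fin states → Bool
      δ₂ : Fin states → Fin states → Letter → Fin states → Bool
      QI : Fin states → Bool
      F  : Fin states → Bool
      C  : Fin states → Bool

  IsBüchi : GMNWA → Set
  IsBüchi B = ∀ q → GMNWA.C B q ≡ false

  module _ (B : GMNWA) where
    open GMNWA B

    IsRun : Word → (ℕ → Fin states) → Set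
    IsRun w ρ =
      (∃ λ q → T (QI q) × T (δ₁ q (w 0) (ρ 0))) ×
      (∀ i → (∀ j → Match w j (suc i) → IsRet (w (suc i)) →
                T (δ₂ (ρ j) (ρ i) (w (suc i)) (ρ (suc i)))) ×
             ((¬ (IsRet (w (suc i)) × ∃ λ j → Match w j (suc i))) →
                T (δ₁ (ρ i) (w (suc i)) (ρ (suc i)))))

    IsAccepting : Word → (ℕ → Fin states) → Set
    IsAccepting w ρ =
      (∀ n → ∃ λ i → n ≤ i × T (F (ρ i))) ×
      (∀ i → T (C (ρ i)) → IsCall (w i) × ∃ λ j → Match w i j)

    Accepts : Word → Set
    Accepts w = ∃ λ ρ → IsRun w ρ × IsAccepting w ρ

-- The Büchi automaton runs B and keeps, for every stack s, a pending bit: it is raised when an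
-- s-call is read in a C-state, and the state reading a call saves the bit of that call's stack,
-- which the matching return restores. For an accepting run of B the bit is set exactly while some
-- C-call of stack s is open; such open calls are nested, so the bit goes off infinitely often.
-- Conversely, a C-call that never returns keeps its bit raised forever. Hence "every C-call is
-- matched" becomes "every pending bit is off infinitely often", and together with "F infinitely
-- often" these finitely many Büchi conditions are merged into one by flags recording, since the
-- last acceptance, a visit to F and a moment with each pending bit off.
module Submission where

open import Defs
open import Data.Product using (Σ; _×_; _,_; proj₁; proj₂; ∃)
open import Function using (_∘_)
open import Function.Bundles using (_⇔_; mk⇔; Equivalence)
open import Data.Nat using (ℕ; zero; suc; _+_; _*_; _∸_; _<_; _≤_; z≤n; s≤s; _<?_; _≤?_; _⊔_)
open import Data.Nat.Properties
  using (_≟_; +-identityʳ; +-monoʳ-<; +-suc; <-asym; <-cmp; <-irrefl; <-trans; <-≤-trans; <⇒≤; ≤-pred;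
         anyUpTo?; m+[n∸m]≡n; m+n∸m≡n; m<1+n⇒m<n∨m≡n; m<n⇒m<1+n; m∸n≢0⇒n<m; m≤m+n;
         m≤n⇒m<n∨m≡n; m≤n⇒m≤1+n; n∸n≡0; n≤1+n; n≮0; ≤-refl; ≤-trans; ≤∧≢⇒<; ≰⇒>; m≤m⊔n; m≤n⊔m)
open import Data.Nat.Induction using (<-rec)
open import Data.Fin as F using (Fin; combine; remQuot)
open import Data.Fin.Properties using (remQuot-combine)
open import Data.List using (List; []; _∷_; _++_; [_]; applyUpTo; length)
open import Data.List.Properties using (++-assoc; ++-identityʳ; applyUpTo-∷ʳ; ∷-injective)
open import Data.Maybe using (Maybe; just; nothing; _>>=_)
import Data.Maybe.Properties as Maybe
open import Data.Bool using (Bool; true; false; T; _∧_; _∨_; not; if_then_else_)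
open import Data.Bool.Properties using (T-∨; T-∧; T-irrelevant)
open import Data.Vec using (Vec; []; _∷_; lookup; tabulate; replicate)
open import Data.Vec.Properties using (lookup∘tabulate; lookup-replicate; tabulate∘lookup; tabulate-cong)
open import Data.Vec.Relation.Unary.All using (all?)
open import Data.Vec.Relation.Unary.All.Properties using (lookup⁺; lookup⁻)
open import Data.Empty using (⊥; ⊥-elim)
open import Data.Sum as Sum using (_⊎_; inj₁; inj₂)
open import Relation.Nullary using (Dec; yes; no; ¬_; does)
open import Relation.Nullary.Decidable
  using (⌊_⌋; _×-dec_; map′; T?; toWitness; fromWitness; isYes≗does; dec-true; dec-false)
open import Relation.Binary.Definitions using (DecidableEquality; tri<; tri≈; tri>)
open import Relation.Binary.PropositionalEquality hiding ([_])

open Equivalence using (to; from)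

module _ {K : ℕ} where

  _≟ᴷ_ : DecidableEquality (Kind K)
  call s ≟ᴷ call s′ = map′ (cong call) (λ { refl → refl }) (s F.≟ s′)
  call _ ≟ᴷ ret _   = no λ ()
  call _ ≟ᴷ int     = no λ ()
  ret _  ≟ᴷ call _  = no λ ()
  ret s  ≟ᴷ ret s′  = map′ (cong ret) (λ { refl → refl }) (s F.≟ s′)
  ret _  ≟ᴷ int     = no λ ()
  int    ≟ᴷ call _  = no λ ()
  int    ≟ᴷ ret _   = no λ ()
  int    ≟ᴷ int     = yes refl

  call-unique : ∀ {k : Kind K} {s s′} → k ≡ call s → k ≡ call s′ → s ≡ s′
  call-unique refl refl = refl

  ret-unique : ∀ {k : Kind K} {s s′} → k ≡ ret s → k ≡ ret s′ → s ≡ s′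
  ret-unique refl refl = refl

  call≢ret : ∀ {k : Kind K} {s s′} → k ≡ call s → k ≡ ret s′ → ⊥
  call≢ret refl ()

-- Well-formedness for stack s is decided by counting the open s-calls:
-- height (just n) x is the count after reading x from count n, nothing on underflow.
module Height (A : Alphabet) (s : Fin (Alphabet.K A)) where
  open Alphabet A

  lower : ℕ → Maybe ℕ
  lower zero    = nothing
  lower (suc n) = just n

  stepKind : ℕ → Kind K → Maybe ℕ
  stepKind n (call s′) = if does (s′ F.≟ s) then just (suc n) else just n
  stepKind n (ret s′)  = if does (s′ F.≟ s) then lower n else just n
  stepKind n int       = just n

  step : ℕ → Letter A → Maybe ℕ
  step n a = stepKind n (kind a)

  height : Maybe ℕ → List (Letter A) → Maybe ℕ
  height m []      = m
  height m (a ∷ x) = height (m >>= λ n → step n a) x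

  height-++ : ∀ m x y → height m (x ++ y) ≡ height (height m x) y
  height-++ m []      y = refl
  height-++ m (a ∷ x) y = height-++ _ x y

  height-nothing : ∀ x → height nothing x ≡ nothing
  height-nothing []      = refl
  height-nothing (a ∷ x) = height-nothing x

  step-call : ∀ {a} n → IsCallOf A s a → step n a ≡ just (suc n)
  step-call n e rewrite e | dec-true (s F.≟ s) refl = refl

  step-ret : ∀ {a} n → IsRetOf A s a → step n a ≡ lower n
  step-ret n e rewrite e | dec-true (s F.≟ s) refl = refl

  step-other : ∀ {a} n → ¬ IsCallOf A s a → ¬ IsRetOf A s a → step n a ≡ just n
  step-other {a} n nc nr with kind a
  ... | call s′ rewrite dec-false (s′ F.≟ s) (λ { refl → nc refl }) = refl
  ... | ret s′  rewrite dec-false (s′ F.≟ s) (λ { refl → nr refl }) = refl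
  ... | int     = refl

  data Class (a : Letter A) : Set where
    call  : IsCallOf A s a → Class a
    ret   : IsRetOf A s a → Class a
    other : ¬ IsCallOf A s a → ¬ IsRetOf A s a → Class a

  classify : ∀ a → Class a
  classify a with kind a ≟ᴷ call s | kind a ≟ᴷ ret s
  ... | yes c | _     = call c
  ... | no nc | yes r = ret r
  ... | no nc | no nr = other nc nr

  wellFormed⇒balanced : ∀ {x} → WellFormed A s x → ∀ n → height (just n) x ≡ just n
  wellFormed⇒balanced (wf-nest {_} {b} {x} c r wf) n
    rewrite step-call n c | height-++ (just (suc n)) x [ b ]
          | wellFormed⇒balanced wf (suc n) | step-ret (suc n) r = refl
  wellFormed⇒balanced (wf-cat {x} {y} wf₁ wf₂) n
    rewrite height-++ (just n) x y | wellFormed⇒balanced wf₁ n | wellFormed⇒balanced wf₂ n = refl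
  wellFormed⇒balanced wf-eps n = refl
  wellFormed⇒balanced (wf-let nc nr) n rewrite step-other n nc nr = refl

  Closes : ℕ → List (Letter A) → Set
  Closes zero    x = WellFormed A s x
  Closes (suc n) x = Σ (List (Letter A)) λ y → Σ (Letter A) λ b → Σ (List (Letter A)) λ z →
    x ≡ y ++ b ∷ z × WellFormed A s y × IsRetOf A s b × Closes n z

  closes-prepend : ∀ {u} → WellFormed A s u → ∀ n {z} → Closes n z → Closes n (u ++ z)
  closes-prepend wu zero    cz = wf-cat wu cz
  closes-prepend {u} wu (suc n) (y , b , z , refl , wy , rb , cz) =
    u ++ y , b , z , sym (++-assoc u y (b ∷ z)) , wf-cat wu wy , rb , cz

  descends⇒closes : ∀ x n → height (just n) x ≡ just 0 → Closes n x
  descends⇒closes [] zero e = wf-eps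
  descends⇒closes (a ∷ x) n e with classify a
  ... | call c rewrite step-call n c with descends⇒closes x (suc n) e
  ...   | y , b , z , refl , wy , rb , cz =
    subst (Closes n) (cong (a ∷_) (++-assoc y [ b ] z)) (closes-prepend (wf-nest c rb wy) n cz)
  descends⇒closes (a ∷ x) zero e | ret r
    rewrite step-ret 0 r | height-nothing x with () ← e
  descends⇒closes (a ∷ x) (suc n) e | ret r rewrite step-ret (suc n) r =
    [] , a , x , refl , wf-eps , r , descends⇒closes x n e
  descends⇒closes (a ∷ x) n e | other nc nr rewrite step-other n nc nr =
    closes-prepend (wf-let nc nr) n (descends⇒closes x n e)

  balanced⇒wellFormed : ∀ x → height (just 0) x ≡ just 0 → WellFormed A s x
  balanced⇒wellFormed x = descends⇒closes x 0

  height-shift : ∀ x {n m} e → height (just n) x ≡ just m → height (just (n + e)) x ≡ just (m + e)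
  height-shift [] e refl = refl
  height-shift (a ∷ x) {n} e h with classify a
  ... | call c rewrite step-call n c | step-call (n + e) c = height-shift x e h
  height-shift (a ∷ x) {zero} e h | ret r rewrite step-ret 0 r | height-nothing x with () ← h
  height-shift (a ∷ x) {suc n} e h | ret r
    rewrite step-ret (suc n) r | step-ret (suc n + e) r = height-shift x e h
  height-shift (a ∷ x) {n} e h | other nc nr
    rewrite step-other n nc nr | step-other (n + e) nc nr = height-shift x e h

  height-prefix : ∀ m x y {k} → height m (x ++ y) ≡ just k → ∃ λ u → height m x ≡ just u
  height-prefix m x y h rewrite height-++ m x y with height m x
  ... | just u  = u , refl
  ... | nothing rewrite height-nothing y with () ← h

  prefix-of-balanced-no-descent : ∀ x y {m k} → height (just 0) (x ++ y) ≡ just m →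
    height (just (suc k)) x ≢ just 0
  prefix-of-balanced-no-descent x y {k = k} h e with height-prefix (just 0) x y h
  ... | u , eu with () ← trans (sym e) (trans (height-shift x (suc k) eu) (cong just (+-suc u k)))

  first-unmatched-return : ∀ x {n} → height (just (suc n)) x ≡ just 0 →
    Σ (List (Letter A)) λ y → Σ (Letter A) λ b → Σ (List (Letter A)) λ z →
      x ≡ y ++ b ∷ z × WellFormed A s y × IsRetOf A s b
  first-unmatched-return x h with descends⇒closes x _ h
  ... | y , b , z , e , wy , rb , _ = y , b , z , e , wy , rb

applyUpTo-split : ∀ {X : Set} (f : ℕ → X) n y b z → applyUpTo f n ≡ y ++ b ∷ z →
  length y < n × applyUpTo f (length y) ≡ y × f (length y) ≡ b
applyUpTo-split f (suc n) []      b z e = s≤s z≤n , refl , proj₁ (∷-injective e)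
applyUpTo-split f (suc n) (x ∷ y) b z e
  with applyUpTo-split (λ t → f (suc t)) n y b z (proj₂ (∷-injective e))
... | l<n , ey , eb = s≤s l<n , cong₂ _∷_ (proj₁ (∷-injective e)) ey , eb

<∸⇒+< : ∀ c r {l} → l < r ∸ c → c + l < r
<∸⇒+< c r {l} l<r∸c = subst (c + l <_) (m+[n∸m]≡n c≤r) (+-monoʳ-< c l<r∸c)
  where
  c≤r : c ≤ r
  c≤r = <⇒≤ (m∸n≢0⇒n<m λ e → n≮0 (subst (l <_) e l<r∸c))

∸-suc : ∀ {i k} → i < k → k ∸ i ≡ suc (k ∸ suc i)
∸-suc {zero}  {suc k} _         = refl
∸-suc {suc i} {suc k} (s≤s i<k) = ∸-suc i<k

module Nesting (A : Alphabet) (w : Word A) where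
  open Alphabet A

  seg : ℕ → ℕ → List (Letter A)
  seg = segment A w

  segment-snoc : ∀ {i k} → i < k → seg i (suc k) ≡ seg i k ++ [ w k ]
  segment-snoc {i} {k} i<k rewrite ∸-suc i<k =
    trans (sym (applyUpTo-∷ʳ (λ t → w (suc i + t)) (k ∸ suc i)))
          (cong (λ t → seg i k ++ [ w t ]) (m+[n∸m]≡n i<k))

  segment-empty : ∀ i → seg i (suc i) ≡ []
  segment-empty i rewrite n∸n≡0 i = refl

  segment-split : ∀ {i j k} → i < j → j < k → seg i k ≡ seg i j ++ w j ∷ seg j k
  segment-split {i} {j} {k} i<j j<k =
    subst (λ k′ → seg i k′ ≡ seg i j ++ w j ∷ seg j k′) (m+[n∸m]≡n j<k) (split-at (k ∸ suc j))
    where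
    split-at : ∀ d → seg i (suc j + d) ≡ seg i j ++ w j ∷ seg j (suc j + d)
    split-at zero rewrite +-identityʳ j | segment-empty j = segment-snoc i<j
    split-at (suc d) rewrite +-suc j d
      | segment-snoc {i} {suc j + d} (<-≤-trans (m<n⇒m<1+n i<j) (m≤m+n (suc j) d))
      | segment-snoc {j} {suc j + d} (m≤m+n (suc j) d)
      | split-at d = ++-assoc (seg i j) (w j ∷ seg j (suc j + d)) [ w (suc j + d) ]

  module _ {s : Fin K} where
    open Height A s

    match-unextendable : ∀ {i j j′} → MatchOf A s w i j → j < j′ → ¬ WellFormed A s (seg i j′)
    match-unextendable {i} {j} {j′} (i<j , _ , rj , wf-ij) j<j′ wf
      with wellFormed⇒balanced wf 0
    ... | e rewrite segment-split i<j j<j′ | height-++ (just 0) (seg i j) (w j ∷ seg j j′)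
                  | wellFormed⇒balanced wf-ij 0 | step-ret 0 rj | height-nothing (seg j j′)
      with () ← e

    descends-inside-match : ∀ {a b c} → MatchOf A s w a b → a < c → c < b → IsCallOf A s (w c) →
      ∃ λ k → height (just (suc k)) (seg c b) ≡ just 0
    descends-inside-match {a} {b} {c} (a<b , _ , _ , wf-ab) a<c c<b cc
      with wellFormed⇒balanced wf-ab 0
    ... | e rewrite segment-split a<c c<b
      with height-prefix (just 0) (seg a c) (w c ∷ seg c b) e
    ... | k , ek rewrite height-++ (just 0) (seg a c) (w c ∷ seg c b) | ek | step-call k cc = k , e

    match-unique : ∀ {i j j′} → MatchOf A s w i j → MatchOf A s w i j′ → j ≡ j′
    match-unique {j = j} {j′} m m′ with <-cmp j j′
    ... | tri< j<j′ _ _ = ⊥-elim (match-unextendable m j<j′ (proj₂ (proj₂ (proj₂ m′))))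
    ... | tri≈ _ j≡j′ _ = j≡j′
    ... | tri> _ _ j′<j = ⊥-elim (match-unextendable m′ j′<j (proj₂ (proj₂ (proj₂ m))))

    matches-nest : ∀ {a b c d} → MatchOf A s w a b → MatchOf A s w c d → a < c → c < b → d < b
    matches-nest {b = b} {c} {d} m-ab (c<d , cc , _ , wf-cd) a<c c<b
      with descends-inside-match m-ab a<c c<b cc | <-cmp d b
    ... | _      | tri< d<b _ _ = d<b
    ... | k , ek | tri≈ _ refl _ = ⊥-elim
      (prefix-of-balanced-no-descent (seg c b) [] (trans (cong (height (just 0)) (++-identityʳ (seg c b)))
        (wellFormed⇒balanced wf-cd 0)) ek)
    ... | k , ek | tri> _ _ b<d = ⊥-elim
      (prefix-of-balanced-no-descent (seg c b) (w b ∷ seg b d)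
        (trans (cong (height (just 0)) (sym (segment-split c<b b<d))) (wellFormed⇒balanced wf-cd 0)) ek)

    enclosing-return⇒enclosing-call : ∀ {c d j t} → MatchOf A s w c d → MatchOf A s w j t →
      c ≤ t → t < d → c < j
    enclosing-return⇒enclosing-call {c} {j = j} m-cd m-jt c≤t t<d with <-cmp c j
    ... | tri< c<j _ _ = c<j
    ... | tri≈ _ refl _ = ⊥-elim (<-irrefl (sym (match-unique m-cd m-jt)) t<d)
    ... | tri> _ _ j<c with m≤n⇒m<n∨m≡n c≤t
    ...   | inj₂ refl = ⊥-elim (call≢ret (proj₁ (proj₂ m-cd)) (proj₁ (proj₂ (proj₂ m-jt))))
    ...   | inj₁ c<t  = ⊥-elim (<-asym (matches-nest m-jt m-cd j<c c<t) t<d)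

    call-inside-match-matched : ∀ {j r c} → MatchOf A s w j r → j < c → c < r → IsCallOf A s (w c) →
      ∃ λ r′ → r′ < r × MatchOf A s w c r′
    call-inside-match-matched {r = r} {c} m j<c c<r cc with descends-inside-match m j<c c<r cc
    ... | k , ek with first-unmatched-return (seg c r) ek
    ... | y , b , z , eq , wf-y , rb with applyUpTo-split (λ t → w (suc c + t)) (r ∸ suc c) y b z eq
    ... | l<r∸c , ey , eb = suc c + length y , <∸⇒+< (suc c) r l<r∸c ,
      (s≤s (m≤m+n c (length y)) , cc , subst (IsRetOf A s) (sym eb) rb ,
       subst (WellFormed A s)
         (sym (trans (cong (applyUpTo (λ t → w (suc c + t))) (m+n∸m≡n (suc c) (length y))) ey)) wf-y)

  MatchOf? : ∀ s j r → Dec (MatchOf A s w j r)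
  MatchOf? s j r =
    (j <? r) ×-dec (kind (w j) ≟ᴷ call s) ×-dec (kind (w r) ≟ᴷ ret s) ×-dec wellFormed?
    where
    open Height A s
    wellFormed? : Dec (WellFormed A s (seg j r))
    wellFormed? = map′ (balanced⇒wellFormed _) (λ wf → wellFormed⇒balanced wf 0)
                       (Maybe.≡-dec _≟_ (height (just 0) (seg j r)) (just 0))

  Match? : ∀ j r → Dec (Match A w j r)
  Match? j r = decide (kind (w j)) refl
    where
    call≢int : ∀ {s} → ¬ _≡_ {A = Kind K} (call s) int
    call≢int ()
    decide : ∀ k → kind (w j) ≡ k → Dec (Match A w j r)
    decide (call s) eq = map′ (s ,_)
      (λ (s′ , m) → subst (λ t → MatchOf A t w j r) (call-unique (proj₁ (proj₂ m)) eq) m)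
      (MatchOf? s j r)
    decide (ret _)  eq = no λ (_ , _ , c , _) → call≢ret c eq
    decide int      eq = no λ (_ , _ , c , _) → call≢int (trans (sym c) eq)

  matching-call? : ∀ r → Dec (∃ λ j → Match A w j r)
  matching-call? r = map′ (λ (j , _ , m) → j , m) (λ (j , m) → j , proj₁ (proj₂ m) , m)
                          (anyUpTo? (λ j → Match? j r) r)

record Enumeration (X : Set) : Set where
  field
    size          : ℕ
    index         : X → Fin size
    element       : Fin size → X
    element-index : ∀ x → element (index x) ≡ x

  ≡-dec : DecidableEquality X
  ≡-dec x y = map′ (λ e → trans (sym (element-index x)) (trans (cong element e) (element-index y)))
               (cong index) (index x F.≟ index y)

open Enumeration

enumFin : ∀ n → Enumeration (Fin n)
enumFin n = record { size = n ; index = λ i → i ; element = λ i → i ; element-index = λ _ → refl }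

enumBool : Enumeration Bool
enumBool = record
  { size = 2 ; index = idx ; element = elt ; element-index = λ { false → refl ; true → refl } }
  where
  idx : Bool → Fin 2
  idx false = F.zero
  idx true  = F.suc F.zero
  elt : Fin 2 → Bool
  elt F.zero    = false
  elt (F.suc _) = true

enum× : ∀ {X Y} → Enumeration X → Enumeration Y → Enumeration (X × Y)
enum× ex ey = record
  { size          = size ex * size ey
  ; index         = λ (x , y) → combine (index ex x) (index ey y)
  ; element       = λ k → let (i , j) = remQuot (size ey) k in element ex i , element ey j
  ; element-index = λ (x , y) → trans (cong (λ (i , j) → element ex i , element ey j)
                                        (remQuot-combine (index ex x) (index ey y)))
                                  (cong₂ _,_ (element-index ex x) (element-index ey y))
  }

enumRetract : ∀ {X Y} (f : X → Y) (g : Y → X) → (∀ x → g (f x) ≡ x) → Enumeration Y → Enumeration X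
enumRetract f g gf ey = record
  { size          = size ey
  ; index         = λ x → index ey (f x)
  ; element       = λ k → g (element ey k)
  ; element-index = λ x → trans (cong g (element-index ey (f x))) (gf x)
  }

enumVec : ∀ {X} → Enumeration X → ∀ n → Enumeration (Vec X n)
enumVec ex zero    = record
  { size = 1 ; index = λ _ → F.zero ; element = λ _ → [] ; element-index = λ { [] → refl } }
enumVec ex (suc n) = enumRetract (λ { (x ∷ v) → x , v }) (λ (x , v) → x ∷ v) (λ { (x ∷ v) → refl })
                                 (enum× ex (enumVec ex n))

Infinite : (ℕ → Bool) → Set
Infinite f = ∀ n → ∃ λ t → n ≤ t × T (f t)

infinite-∘suc : ∀ {f} → Infinite f → Infinite (λ t → f (suc t))
infinite-∘suc inf n with inf (suc n)
... | suc t , s≤s n≤t , ft = t , n≤t , ft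

infinite-∘suc⁻ : ∀ {f} → Infinite (λ t → f (suc t)) → Infinite f
infinite-∘suc⁻ inf n with inf n
... | t , n≤t , ft = suc t , m≤n⇒m≤1+n n≤t , ft

¬T⇒T-not : ∀ {b} → ¬ T b → T (not b)
¬T⇒T-not {false} _  = _
¬T⇒T-not {true}  nb = nb _

T-injective : ∀ {a b} → (T a → T b) → (T b → T a) → a ≡ b
T-injective {false} {false} _ _ = refl
T-injective {false} {true}  _ g = ⊥-elim (g _)
T-injective {true}  {false} f _ = ⊥-elim (f _)
T-injective {true}  {true}  _ _ = refl

T-not⇒¬T : ∀ {b} → T (not b) → ¬ T b
T-not⇒¬T {false} _ ()

maxOver : ∀ {k} → (Fin k → ℕ) → ℕ
maxOver {zero}  f = 0
maxOver {suc k} f = f F.zero ⊔ maxOver (λ i → f (F.suc i))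

≤-maxOver : ∀ {k} (f : Fin k → ℕ) i → f i ≤ maxOver f
≤-maxOver f F.zero    = m≤m⊔n _ _
≤-maxOver f (F.suc i) = ≤-trans (≤-maxOver (λ i → f (F.suc i)) i) (m≤n⊔m _ _)

-- The flags of the usual reduction of a conjunction of Büchi conditions to a single one.
module ResetFlags (accept : ℕ → Bool) where

  record ResetFlag (flag cond : ℕ → Bool) : Set where
    field
      initial : flag 0 ≡ false
      next    : ∀ t → flag (suc t) ≡ (not (accept t) ∧ flag t) ∨ cond (suc t)

  Quiet : ℕ → ℕ → Set
  Quiet u t = ∀ v → u ≤ v → v < t → T (not (accept v))

  module _ {flag cond : ℕ → Bool} (r : ResetFlag flag cond) where
    open ResetFlag r

    flag-set : ∀ {t} → 0 < t → T (cond t) → T (flag t)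
    flag-set {suc t} _ c = subst T (sym (next t)) (from T-∨ (inj₂ c))

    flag-persists : ∀ {t t′} → t ≤ t′ → T (flag t) → Quiet t t′ → T (flag t′)
    flag-persists {t′ = zero} z≤n ft _ = ft
    flag-persists {t′ = suc t′} t≤ ft quiet with m≤n⇒m<n∨m≡n t≤
    ... | inj₂ refl = ft
    ... | inj₁ (s≤s t≤t′) = subst T (sym (next t′)) (from T-∨ (inj₁ (from T-∧
            (quiet t′ t≤t′ ≤-refl , flag-persists t≤t′ ft λ v t≤v v<t′ → quiet v t≤v (m<n⇒m<1+n v<t′)))))

    flag-witness : ∀ t → T (flag t) → ∃ λ u → u ≤ t × T (cond u) × Quiet u t
    flag-witness zero f = ⊥-elim (subst T initial f)
    flag-witness (suc t) f with to T-∨ (subst T (next t) f)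
    ... | inj₂ c = suc t , ≤-refl , c , λ v t<v v<t → ⊥-elim (<-irrefl refl (<-≤-trans v<t t<v))
    ... | inj₁ nf with to T-∧ nf
    ...   | na , ft with flag-witness t ft
    ...     | u , u≤t , c , quiet = u , m≤n⇒m≤1+n u≤t , c , quiet′
      where
      quiet′ : Quiet u (suc t)
      quiet′ v u≤v v<1+t with m<1+n⇒m<n∨m≡n v<1+t
      ... | inj₁ v<t = quiet v u≤v v<t
      ... | inj₂ refl = na

    flag-sound : (∀ t → T (accept t) → T (flag t)) → Infinite accept → Infinite cond
    flag-sound accept⇒flag acc n with acc n
    ... | t₁ , n≤t₁ , a₁ with acc (suc t₁)
    ... | t₂ , t₁<t₂ , a₂ with flag-witness t₂ (accept⇒flag t₂ a₂)
    ... | u , _ , c , quiet with u ≤? t₁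
    ... | yes u≤t₁ = ⊥-elim (T-not⇒¬T (quiet t₁ u≤t₁ t₁<t₂) a₁)
    ... | no u≰t₁ = u , ≤-trans n≤t₁ (<⇒≤ (≰⇒> u≰t₁)) , c

  flags-complete : ∀ {k} (flag cond : Fin k → ℕ → Bool) → (∀ i → ResetFlag (flag i) (cond i)) →
    (∀ t → (∀ i → T (flag i t)) → T (accept t)) → (∀ i → Infinite (cond i)) → Infinite accept
  flags-complete flag cond r flags⇒accept infinite n =
    search (anyUpTo? (λ v → (n ≤? v) ×-dec T? (accept v)) (suc horizon))
    where
    witness : Fin _ → ℕ
    witness i = proj₁ (infinite i (suc n))
    horizon : ℕ
    horizon = suc n ⊔ maxOver witness
    n<horizon : n < horizon
    n<horizon = m≤m⊔n (suc n) (maxOver witness)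
    witness≤horizon : ∀ i → witness i ≤ horizon
    witness≤horizon i = ≤-trans (≤-maxOver witness i) (m≤n⊔m (suc n) (maxOver witness))
    search : Dec (∃ λ v → v < suc horizon × n ≤ v × T (accept v)) → ∃ λ t → n ≤ t × T (accept t)
    search (yes (t , _ , n≤t , a)) = t , n≤t , a
    search (no none) = ⊥-elim (none (horizon , ≤-refl , <⇒≤ n<horizon , flags⇒accept horizon all-set))
      where
      all-set : ∀ i → T (flag i horizon)
      all-set i =
        let _ , n<tᵢ , c = infinite i (suc n)
        in flag-persists (r i) (witness≤horizon i) (flag-set (r i) (<-≤-trans (s≤s z≤n) n<tᵢ) c)
             λ v tᵢ≤v v<h → ¬T⇒T-not λ a → none (v , m<n⇒m<1+n v<h , ≤-trans (<⇒≤ n<tᵢ) tᵢ≤v , a)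

module Runs (A : Alphabet) (B : GMNWA A) (w : Word A) where
  open GMNWA B

  -- r t is the state after reading the first t letters, so r 0 is the initial state
  Transition : (ℕ → Fin states) → ℕ → Set
  Transition r t =
    (∀ j → Match A w j t → T (δ₂ (r (suc j)) (r t) (w t) (r (suc t)))) ×
    (¬ (∃ λ j → Match A w j t) → T (δ₁ (r t) (w t) (r (suc t))))

  before : Fin states → (ℕ → Fin states) → ℕ → Fin states
  before q₀ ρ zero    = q₀
  before q₀ ρ (suc t) = ρ t

  private
    return-of-match : ∀ {j t} → Match A w j t → IsRet A (w t)
    return-of-match (s , _ , _ , r , _) = s , r

    no-match-at-0 : ¬ (∃ λ j → Match A w j 0)
    no-match-at-0 (_ , _ , () , _)

  run⇒transitions : ∀ {ρ} → IsRun A B w ρ → ∃ λ q₀ → T (QI q₀) × ∀ t → Transition (before q₀ ρ) t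
  run⇒transitions {ρ} ((q₀ , i , d) , steps) = q₀ , i , transition
    where
    transition : ∀ t → Transition (before q₀ ρ) t
    transition zero    = (λ j m → ⊥-elim (no-match-at-0 (j , m))) , λ _ → d
    transition (suc t) = (λ j m → proj₁ (steps t) j m (return-of-match m)) ,
                         λ nm → proj₂ (steps t) λ (_ , m) → nm m

  transitions⇒run : ∀ r → T (QI (r 0)) → (∀ t → Transition r t) → IsRun A B w (λ t → r (suc t))
  transitions⇒run r i tr =
    (r 0 , i , proj₂ (tr 0) no-match-at-0) ,
    λ t → (λ j m _ → proj₁ (tr (suc t)) j m) ,
          λ nm → proj₂ (tr (suc t)) λ m → nm (return-of-match (proj₂ m) , m)

⌊⌋-true : ∀ {P : Set} (d : Dec P) → P → ⌊ d ⌋ ≡ true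
⌊⌋-true d p = trans (isYes≗does d) (dec-true d p)

⌊⌋-false : ∀ {P : Set} (d : Dec P) → ¬ P → ⌊ d ⌋ ≡ false
⌊⌋-false d np = trans (isYes≗does d) (dec-false d np)

lookup-extensional : ∀ {X : Set} {n} {u v : Vec X n} → (∀ i → lookup u i ≡ lookup v i) → u ≡ v
lookup-extensional {u = u} {v} eq =
  trans (sym (tabulate∘lookup u)) (trans (tabulate-cong eq) (tabulate∘lookup v))

module Construction (A : Alphabet) (B : GMNWA A) where
  open Alphabet A
  open GMNWA B
  open ResetFlags

  -- saved is the pending bit of the stack of the call just read (false after other letters);
  -- cleared s and visited record, since the last acceptance, that pending s was off at some
  -- moment and that F was visited.
  record State : Set where
    constructor state
    field
      current : Fin states
      pending : Vec Bool K
      saved   : Bool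
      cleared : Vec Bool K
      visited : Bool
  open State public

  -- abstract, so that the arithmetic of the encoding is never unfolded during type checking
  abstract
   enumState : Enumeration State
   enumState = enumRetract
     (λ x → current x , pending x , saved x , cleared x , visited x)
     (λ (q , o , b , z , v) → state q o b z v) (λ _ → refl)
     (enum× (enumFin states) (enum× (enumVec enumBool K)
       (enum× enumBool (enum× (enumVec enumBool K) enumBool))))

  encode : State → Fin (Enumeration.size enumState)
  encode = index enumState

  decode : Fin (Enumeration.size enumState) → State
  decode = element enumState

  decode-encode : ∀ x → decode (encode x) ≡ x
  decode-encode = element-index enumState

  isCallOf : Fin K → Letter A → Bool
  isCallOf s a = ⌊ kind a ≟ᴷ call s ⌋

  isRetOf : Fin K → Letter A → Bool
  isRetOf s a = ⌊ kind a ≟ᴷ ret s ⌋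

  isCallKind : Kind K → Bool
  isCallKind (call _) = true
  isCallKind (ret _)  = false
  isCallKind int      = false

  pendingAtKind : Vec Bool K → Kind K → Bool
  pendingAtKind o (call s) = lookup o s
  pendingAtKind o (ret _)  = false
  pendingAtKind o int      = false

  pendingAt : Vec Bool K → Letter A → Bool
  pendingAt o a = pendingAtKind o (kind a)

  callsOnly : Letter A → Fin states → Bool
  callsOnly a q = not (C q) ∨ isCallKind (kind a)

  opened : Vec Bool K → Letter A → Fin states → Vec Bool K
  opened o a q = tabulate λ s → lookup o s ∨ (isCallOf s a ∧ C q)

  closed : Vec Bool K → Bool → Letter A → Vec Bool K
  closed o b a = tabulate λ s → if isRetOf s a then b else lookup o s

  accepting : State → Bool
  accepting x = visited x ∧ ⌊ all? T? (cleared x) ⌋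

  reset : State → Bool → Bool
  reset x b = not (accepting x) ∧ b

  successor : State → Letter A → Fin states → Vec Bool K → State
  successor x a q o = state q o (pendingAt (pending x) a)
    (tabulate λ s → reset x (lookup (cleared x) s) ∨ not (lookup o s))
    (reset x (visited x) ∨ F q)

  initial : Fin states → State
  initial q = state q (replicate K false) false (replicate K false) false

  Initial : State → Set
  Initial x = T (QI (current x)) × x ≡ initial (current x)

  Internal : State → Letter A → State → Set
  Internal x a x′ = T (δ₁ (current x) a (current x′)) × T (callsOnly a (current x′)) ×
                    x′ ≡ successor x a (current x′) (opened (pending x) a (current x′))

  Return : State → State → Letter A → State → Set
  Return xc x a x′ = T (δ₂ (current xc) (current x) a (current x′)) × T (callsOnly a (current x′)) ×
                     x′ ≡ successor x a (current x′) (closed (pending x) (saved xc) a)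

  Initial? : ∀ x → Dec (Initial x)
  Initial? x = T? _ ×-dec ≡-dec enumState _ _

  Internal? : ∀ x a x′ → Dec (Internal x a x′)
  Internal? x a x′ = T? _ ×-dec T? _ ×-dec ≡-dec enumState _ _

  Return? : ∀ xc x a x′ → Dec (Return xc x a x′)
  Return? xc x a x′ = T? _ ×-dec T? _ ×-dec ≡-dec enumState _ _

  büchi : GMNWA A
  büchi = record
    { states = Enumeration.size enumState
    ; δ₁     = λ i a j → ⌊ Internal? (decode i) a (decode j) ⌋
    ; δ₂     = λ i j a k → ⌊ Return? (decode i) (decode j) a (decode k) ⌋
    ; QI     = λ i → ⌊ Initial? (decode i) ⌋
    ; F      = λ i → accepting (decode i)
    ; C      = λ _ → false
    }

  Follows : State → Letter A → State → Set
  Follows x a x′ = x′ ≡ successor x a (current x′) (pending x′)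

  follows : ∀ x a {x′ q o} → x′ ≡ successor x a q o → Follows x a x′
  follows x a refl = refl

  callsOnly-sound : ∀ {a q} → T (callsOnly a q) → T (C q) → IsCall A a
  callsOnly-sound {a} {q} ok c with C q
  ... | true = call-kind (kind a) refl ok
    where
    call-kind : ∀ k → kind a ≡ k → T (isCallKind k) → IsCall A a
    call-kind (call s) eq _ = s , eq

  callsOnly-complete : ∀ {a q} → (T (C q) → IsCall A a) → T (callsOnly a q)
  callsOnly-complete {a} {q} call? with C q
  ... | false = _
  ... | true with (s , eq) ← call? _ rewrite eq = _

  pendingAt-call : ∀ {s a} o → IsCallOf A s a → pendingAt o a ≡ lookup o s
  pendingAt-call o eq rewrite eq = refl

  opened⁺ : ∀ o a q s → T (lookup o s) ⊎ (IsCallOf A s a × T (C q)) → T (lookup (opened o a q) s)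
  opened⁺ o a q s b = subst T (sym (lookup∘tabulate (λ s → lookup o s ∨ (isCallOf s a ∧ C q)) s))
    (from (T-∨ {lookup o s}) (Sum.map₂ (λ (c , p) → from (T-∧ {isCallOf s a}) (fromWitness c , p)) b))

  opened⁻ : ∀ o a q s → T (lookup (opened o a q) s) → T (lookup o s) ⊎ (IsCallOf A s a × T (C q))
  opened⁻ o a q s b = Sum.map₂ (λ cp → let c , p = to (T-∧ {isCallOf s a}) cp in toWitness c , p)
    (to (T-∨ {lookup o s}) (subst T (lookup∘tabulate (λ s → lookup o s ∨ (isCallOf s a ∧ C q)) s) b))

  lookup-closed-ret : ∀ {s a} o b → IsRetOf A s a → lookup (closed o b a) s ≡ b
  lookup-closed-ret {s} {a} o b r
    rewrite lookup∘tabulate (λ s → if isRetOf s a then b else lookup o s) s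
          | ⌊⌋-true (kind a ≟ᴷ ret s) r = refl

  lookup-closed-other : ∀ {s a} o b → ¬ IsRetOf A s a → lookup (closed o b a) s ≡ lookup o s
  lookup-closed-other {s} {a} o b nr
    rewrite lookup∘tabulate (λ s → if isRetOf s a then b else lookup o s) s
          | ⌊⌋-false (kind a ≟ᴷ ret s) nr = refl

  initial⇒QI : ∀ {x} → Initial x → T (GMNWA.QI büchi (encode x))
  initial⇒QI {x} i rewrite decode-encode x = fromWitness i

  internal⇒δ₁ : ∀ {x a x′} → Internal x a x′ → T (GMNWA.δ₁ büchi (encode x) a (encode x′))
  internal⇒δ₁ {x} {a} {x′} i rewrite decode-encode x | decode-encode x′ = fromWitness i

  return⇒δ₂ : ∀ {xc x a x′} → Return xc x a x′ → T (GMNWA.δ₂ büchi (encode xc) (encode x) a (encode x′))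
  return⇒δ₂ {xc} {x} {a} {x′} r
    rewrite decode-encode xc | decode-encode x | decode-encode x′ = fromWitness r

  accepting⇒F : ∀ {x} → T (accepting x) → T (GMNWA.F büchi (encode x))
  accepting⇒F {x} acc rewrite decode-encode x = acc

  accepting⇒cleared : ∀ x s → T (accepting x) → T (lookup (cleared x) s)
  accepting⇒cleared x s acc =
    lookup⁺ (toWitness {a? = all? T? (cleared x)} (proj₂ (to (T-∧ {visited x}) acc))) s

  accepting⇒visited : ∀ x → T (accepting x) → T (visited x)
  accepting⇒visited x acc = proj₁ (to (T-∧ {visited x}) acc)

  flags⇒accepting : ∀ x → T (visited x) → (∀ s → T (lookup (cleared x) s)) → T (accepting x)
  flags⇒accepting x v z = from (T-∧ {visited x}) (v , fromWitness {a? = all? T? (cleared x)} (lookup⁻ z))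

  module _ (w : Word A) (x : ℕ → State) (x₀ : x 0 ≡ initial (current (x 0)))
           (step : ∀ t → Follows (x t) (w t) (x (suc t))) where

    visited-resets : ResetFlag (accepting ∘ x) (visited ∘ x) (F ∘ current ∘ x)
    visited-resets = record { initial = cong visited x₀ ; next = λ t → cong visited (step t) }

    cleared-resets : ∀ s → ResetFlag (accepting ∘ x) (λ n → lookup (cleared (x n)) s)
                                                    (λ n → not (lookup (pending (x n)) s))
    cleared-resets s = record
      { initial = trans (cong (λ y → lookup (cleared y) s) x₀) (lookup-replicate s false)
      ; next    = λ t → trans (cong (λ y → lookup (cleared y) s) (step t)) (lookup∘tabulate _ s)
      }

module Soundness (A : Alphabet) (B : GMNWA A) (w : Word A) where
  open Alphabet A
  open GMNWA B
  open Construction A B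
  open Nesting A w
  module R′ = Runs A büchi w

  module _ {ρ′} (run : IsRun A büchi w ρ′) (acc : IsAccepting A büchi w ρ′) where

    x : ℕ → State
    x n = decode (R′.before (proj₁ (R′.run⇒transitions run)) ρ′ n)

    r : ℕ → Fin states
    r n = current (x n)

    transition : ∀ t → R′.Transition (R′.before (proj₁ (R′.run⇒transitions run)) ρ′) t
    transition = proj₂ (proj₂ (R′.run⇒transitions run))

    x₀ : Initial (x 0)
    x₀ = toWitness (proj₁ (proj₂ (R′.run⇒transitions run)))

    data Step (t : ℕ) : Set where
      internal : ¬ (∃ λ j → Match A w j t) → Internal (x t) (w t) (x (suc t)) → Step t
      return   : ∀ j → Match A w j t → Return (x (suc j)) (x t) (w t) (x (suc t)) → Step t

    step : ∀ t → Step t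
    step t with matching-call? t
    ... | yes (j , m) = return j m (toWitness (proj₁ (transition t) j m))
    ... | no nm       = internal nm (toWitness (proj₂ (transition t) nm))

    follows-step : ∀ t → Follows (x t) (w t) (x (suc t))
    follows-step t with step t
    ... | internal _ (_ , _ , eq) = follows (x t) (w t) eq
    ... | return _ _ (_ , _ , eq) = follows (x t) (w t) eq

    calls-only : ∀ t → T (callsOnly (w t) (r (suc t)))
    calls-only t with step t
    ... | internal _ (_ , ok , _) = ok
    ... | return _ _ (_ , ok , _) = ok

    runs : IsRun A B w (r ∘ suc)
    runs = Runs.transitions⇒run A B w r (proj₁ x₀) λ t →
      (λ j m → proj₁ (toWitness (proj₁ (transition t) j m))) ,
      (λ nm → proj₁ (toWitness (proj₂ (transition t) nm)))

    infinitely-accepting : Infinite (accepting ∘ x)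
    infinitely-accepting = infinite-∘suc⁻ (proj₁ acc)

    infinitely-F : Infinite (F ∘ r ∘ suc)
    infinitely-F = infinite-∘suc (ResetFlags.flag-sound (accepting ∘ x)
      (visited-resets w x (proj₂ x₀) follows-step) (accepting⇒visited ∘ x) infinitely-accepting)

    infinitely-not-pending : ∀ s → Infinite (λ n → not (lookup (pending (x n)) s))
    infinitely-not-pending s = ResetFlags.flag-sound (accepting ∘ x)
      (cleared-resets w x (proj₂ x₀) follows-step s) (λ t → accepting⇒cleared (x t) s) infinitely-accepting

    Raised : Fin K → ℕ → Set
    Raised s n = T (lookup (pending (x n)) s)

    Unmatched : ℕ → ℕ → Set
    Unmatched c n = ¬ (∃ λ j → j < n × Match A w c j)

    raised-after-internal : ∀ {t} s → Internal (x t) (w t) (x (suc t)) →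
      Raised s t ⊎ (IsCallOf A s (w t) × T (C (r (suc t)))) → Raised s (suc t)
    raised-after-internal {t} s (_ , _ , eq) b =
      subst T (sym (cong (λ y → lookup (pending y) s) eq)) (opened⁺ (pending (x t)) (w t) (r (suc t)) s b)

    raised-after-other-return : ∀ {s t xc} → ¬ IsRetOf A s (w t) → Return xc (x t) (w t) (x (suc t)) →
      Raised s t → Raised s (suc t)
    raised-after-other-return {s} {t} {xc} nrt (_ , _ , eq) = subst T (sym
      (trans (cong (λ y → lookup (pending y) s) eq) (lookup-closed-other (pending (x t)) (saved xc) nrt)))

    raised-restored : ∀ {s j t} → MatchOf A s w j t → Return (x (suc j)) (x t) (w t) (x (suc t)) →
      lookup (pending (x (suc t))) s ≡ lookup (pending (x j)) s
    raised-restored {s} {j} {t} (_ , cj , rt , _) (_ , _ , eq) = begin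
      lookup (pending (x (suc t))) s
        ≡⟨ cong (λ y → lookup (pending y) s) eq ⟩
      lookup (closed (pending (x t)) (saved (x (suc j))) (w t)) s
        ≡⟨ lookup-closed-ret (pending (x t)) _ rt ⟩
      saved (x (suc j))
        ≡⟨ cong saved (follows-step j) ⟩
      pendingAt (pending (x j)) (w j)
        ≡⟨ pendingAt-call (pending (x j)) cj ⟩
      lookup (pending (x j)) s
        ∎
      where open ≡-Reasoning

    raised-after-own-return : ∀ {s c j t} → IsCallOf A s (w c) → c < t → Unmatched c (suc t) →
      MatchOf A s w j t → Return (x (suc j)) (x t) (w t) (x (suc t)) → (c < j → Raised s j) → Raised s (suc t)
    raised-after-own-return {s} {c} {j} {t} cc c<t unmatched m tr raised-j with <-cmp j c
    ... | tri< j<c _ _ = ⊥-elim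
      (let j′ , j′<t , m′ = call-inside-match-matched m j<c c<t cc
       in unmatched (j′ , m<n⇒m<1+n j′<t , s , m′))
    ... | tri≈ _ refl _ = ⊥-elim (unmatched (t , ≤-refl , s , m))
    ... | tri> _ _ c<j = subst T (sym (raised-restored m tr)) (raised-j c<j)

    raised-at-call : ∀ {c s} → IsCallOf A s (w c) → T (C (r (suc c))) → Raised s (suc c)
    raised-at-call {c} {s} cc p with step c
    ... | internal _ i = raised-after-internal s i (inj₂ (cc , p))
    ... | return _ (_ , _ , _ , rc , _) _ = ⊥-elim (call≢ret cc rc)

    unmatched-stays-raised : ∀ {s c} → IsCallOf A s (w c) → Raised s (suc c) →
      ∀ n → suc c ≤ n → Unmatched c n → Raised s n
    unmatched-stays-raised {s} {c} cc raised₀ = <-rec _ go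
      where
      go : ∀ n → (∀ {m} → m < n → suc c ≤ m → Unmatched c m → Raised s m) →
           suc c ≤ n → Unmatched c n → Raised s n
      go (suc t) ih (s≤s c≤t) unmatched with m≤n⇒m<n∨m≡n c≤t
      ... | inj₂ refl = raised₀
      ... | inj₁ c<t = raised-after (step t)
        where
        earlier : ∀ {m} → m ≤ t → suc c ≤ m → Raised s m
        earlier m≤t c<m = ih (s≤s m≤t) c<m
          λ (j , j<m , mj) → unmatched (j , <-≤-trans j<m (m≤n⇒m≤1+n m≤t) , mj)

        raised-after : Step t → Raised s (suc t)
        raised-after (internal _ i) = raised-after-internal s i (inj₁ (earlier ≤-refl c<t))
        raised-after (return j (_ , m) tr) with kind (w t) ≟ᴷ ret s
        ... | no nrt = raised-after-other-return {xc = x (suc j)} nrt tr (earlier ≤-refl c<t)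
        ... | yes rt with refl ← ret-unique (proj₁ (proj₂ (proj₂ m))) rt =
          raised-after-own-return cc c<t unmatched m tr (earlier (<⇒≤ (proj₁ m)))

    calls-matched : ∀ c → T (C (r (suc c))) → IsCall A (w c) × ∃ λ j → Match A w c j
    calls-matched c p with callsOnly-sound (calls-only c) p
    ... | s , cc with infinitely-not-pending s (suc c)
    ... | u , c<u , not-pending with anyUpTo? (Match? c) u
    ... | yes (j , _ , m) = (s , cc) , j , m
    ... | no unmatched = ⊥-elim (T-not⇒¬T not-pending
            (unmatched-stays-raised cc (raised-at-call cc p) u c<u unmatched))

  sound : Accepts A büchi w → Accepts A B w
  sound (_ , run , acc) = _ , runs run acc , infinitely-F run acc , calls-matched run acc

module Completeness (A : Alphabet) (B : GMNWA A) (w : Word A) where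
  open Alphabet A
  open GMNWA B
  open Construction A B
  open Nesting A w
  module R = Runs A B w

  module _ {ρ} (run : IsRun A B w ρ) (acc : IsAccepting A B w ρ) where

    r : ℕ → Fin states
    r = R.before (proj₁ (R.run⇒transitions run)) ρ

    transition : ∀ t → R.Transition r t
    transition = proj₂ (proj₂ (R.run⇒transitions run))

    return-of : ∀ c → T (C (ρ c)) → ℕ
    return-of c p = proj₁ (proj₂ (proj₂ acc c p))

    returns-to : ∀ {s} c p → IsCallOf A s (w c) → MatchOf A s w c (return-of c p)
    returns-to c p cc with proj₂ (proj₂ (proj₂ acc c p))
    ... | _ , m = subst (λ s → MatchOf A s w c _) (call-unique (proj₁ (proj₂ m)) cc) m

    Open : Fin K → ℕ → ℕ → Set
    Open s n c = Σ (T (C (ρ c))) λ p → IsCallOf A s (w c) × n ≤ return-of c p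

    -- the intended value of the pending bit of stack s after n letters
    Pending : Fin K → ℕ → Set
    Pending s n = ∃ λ c → c < n × Open s n c

    Open? : ∀ s n c → Dec (Open s n c)
    Open? s n c = decide (T? (C (ρ c)))
      where
      decide : Dec (T (C (ρ c))) → Dec (Open s n c)
      decide (no ¬p) = no (¬p ∘ proj₁)
      decide (yes p) = map′ (p ,_)
        (λ (p′ , o) → subst (λ p → IsCallOf A s (w c) × n ≤ return-of c p) (T-irrelevant p′ p) o)
        ((kind (w c) ≟ᴷ call s) ×-dec (n ≤? return-of c p))

    Pending? : ∀ s n → Dec (Pending s n)
    Pending? s n = anyUpTo? (Open? s n) n

    pendingAfter : ℕ → Vec Bool K
    pendingAfter n = tabulate λ s → ⌊ Pending? s n ⌋

    pending⁺ : ∀ {s n} → Pending s n → T (lookup (pendingAfter n) s)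
    pending⁺ {s} {n} p = subst T (sym (lookup∘tabulate (λ s → ⌊ Pending? s n ⌋) s)) (fromWitness p)

    pending⁻ : ∀ {s n} → T (lookup (pendingAfter n) s) → Pending s n
    pending⁻ {s} {n} b = toWitness (subst T (lookup∘tabulate (λ s → ⌊ Pending? s n ⌋) s) b)

    pendingAfter-0 : pendingAfter 0 ≡ replicate K false
    pendingAfter-0 = lookup-extensional λ s →
      trans (lookup∘tabulate (λ s → ⌊ Pending? s 0 ⌋) s) (sym (lookup-replicate s false))

    still-pending : ∀ {s t} → Pending s t → ¬ (∃ λ c → MatchOf A s w c t) → Pending s (suc t)
    still-pending {s} (c , c<t , p , cc , t≤ret) unmatched =
      c , m<n⇒m<1+n c<t , p , cc ,
      ≤∧≢⇒< t≤ret λ t≡ret → unmatched (c , subst (MatchOf A s w c) (sym t≡ret) (returns-to c p cc))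

    pending-or-opened : ∀ {s t} → Pending s (suc t) → Pending s t ⊎ (IsCallOf A s (w t) × T (C (ρ t)))
    pending-or-opened (c , c<1+t , p , cc , t<ret) with m<1+n⇒m<n∨m≡n c<1+t
    ... | inj₁ c<t  = inj₁ (c , c<t , p , cc , <⇒≤ t<ret)
    ... | inj₂ refl = inj₂ (cc , p)

    opened-pending : ∀ {s t} → IsCallOf A s (w t) → T (C (ρ t)) → Pending s (suc t)
    opened-pending {t = t} cc p = t , ≤-refl , p , cc , proj₁ (returns-to t p cc)

    pending-at-return⇒at-call : ∀ {s j t} → MatchOf A s w j t → Pending s (suc t) → Pending s j
    pending-at-return⇒at-call m@(j<t , _) (c , c<1+t , p , cc , t<ret) =
      c , enclosing-return⇒enclosing-call (returns-to c p cc) m (≤-pred c<1+t) t<ret , p , cc ,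
      <⇒≤ (<-trans j<t t<ret)

    pending-at-call⇒at-return : ∀ {s j t} → MatchOf A s w j t → Pending s j → Pending s (suc t)
    pending-at-call⇒at-return {s} m@(j<t , cj , _) (c , c<j , p , cc , j≤ret) =
      c , m<n⇒m<1+n (<-trans c<j j<t) , p , cc , matches-nest m-c m c<j j<ret
      where
      m-c = returns-to c p cc
      j<ret = ≤∧≢⇒< j≤ret λ e →
        call≢ret cj (subst (λ i → IsRetOf A s (w i)) (sym e) (proj₁ (proj₂ (proj₂ m-c))))

    pending-internal : ∀ t → ¬ (∃ λ j → Match A w j t) →
      pendingAfter (suc t) ≡ opened (pendingAfter t) (w t) (ρ t)
    pending-internal t unmatched = lookup-extensional λ s → T-injective
      (λ b → opened⁺ (pendingAfter t) (w t) (ρ t) s (Sum.map₁ pending⁺ (pending-or-opened (pending⁻ b))))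
      (λ b → pending⁺ (backward (opened⁻ (pendingAfter t) (w t) (ρ t) s b)))
      where
      backward : ∀ {s} → T (lookup (pendingAfter t) s) ⊎ (IsCallOf A s (w t) × T (C (ρ t))) →
                 Pending s (suc t)
      backward (inj₁ b)        = still-pending (pending⁻ b) λ (c , m) → unmatched (c , _ , m)
      backward (inj₂ (cc , p)) = opened-pending cc p

    pending-return : ∀ {j t} → Match A w j t →
      pendingAfter (suc t) ≡ closed (pendingAfter t) (pendingAt (pendingAfter j) (w j)) (w t)
    pending-return {j} {t} (s₀ , m@(_ , cj , rt , _)) = lookup-extensional pointwise
      where
      pointwise : ∀ s → lookup (pendingAfter (suc t)) s ≡
                        lookup (closed (pendingAfter t) (pendingAt (pendingAfter j) (w j)) (w t)) s
      pointwise s with kind (w t) ≟ᴷ ret s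
      ... | yes rt′ with refl ← ret-unique rt rt′ = trans
        (T-injective (pending⁺ ∘ pending-at-return⇒at-call m ∘ pending⁻)
                     (pending⁺ ∘ pending-at-call⇒at-return m ∘ pending⁻))
        (sym (trans (lookup-closed-ret (pendingAfter t) (pendingAt (pendingAfter j) (w j)) rt)
                    (pendingAt-call (pendingAfter j) cj)))
      ... | no nrt = trans
        (T-injective (pending⁺ ∘ unchanged ∘ pending-or-opened ∘ pending⁻)
                     (λ b → pending⁺ (still-pending (pending⁻ b)
                                        λ (_ , m′) → nrt (proj₁ (proj₂ (proj₂ m′))))))
        (sym (lookup-closed-other (pendingAfter t) (pendingAt (pendingAfter j) (w j)) nrt))
        where
        unchanged : Pending s t ⊎ (IsCallOf A s (w t) × T (C (ρ t))) → Pending s t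
        unchanged (inj₁ p)       = p
        unchanged (inj₂ (ct , _)) = ⊥-elim (call≢ret ct rt)

    closes-eventually : ∀ {s} c (p : T (C (ρ c))) → IsCallOf A s (w c) →
      ∃ λ n → return-of c p < n × ¬ Pending s n
    closes-eventually {s} = <-rec Closes go
      where
      Closes : ℕ → Set
      Closes c = ∀ p → IsCallOf A s (w c) → ∃ λ n → return-of c p < n × ¬ Pending s n
      -- a C-call still open just after the return of c must precede c, so we descend on c
      go : ∀ c → (∀ {c′} → c′ < c → Closes c′) → Closes c
      go c ih p cc with Pending? s (suc (return-of c p))
      ... | no np = suc (return-of c p) , ≤-refl , np
      ... | yes (c′ , c′≤ret , p′ , cc′ , ret<ret′) with <-cmp c′ c
      ...   | tri< c′<c _ _ = let n , ret′<n , np = ih c′<c p′ cc′ in n , <-trans ret<ret′ ret′<n , np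
      ...   | tri≈ _ refl _ = ⊥-elim (<-irrefl (cong (return-of c) (T-irrelevant p p′)) ret<ret′)
      ...   | tri> _ _ c<c′ with m<1+n⇒m<n∨m≡n c′≤ret
      ...     | inj₁ c′<ret = ⊥-elim
        (<-asym (matches-nest (returns-to c p cc) (returns-to c′ p′ cc′) c<c′ c′<ret) ret<ret′)
      ...     | inj₂ refl   = ⊥-elim (call≢ret cc′ (proj₁ (proj₂ (proj₂ (returns-to c p cc)))))

    infinitely-not-pending : ∀ s → Infinite (λ n → not (lookup (pendingAfter n) s))
    infinitely-not-pending s n with Pending? s n
    ... | no np = n , ≤-refl , ¬T⇒T-not (np ∘ pending⁻)
    ... | yes (c , _ , p , cc , n≤ret) with closes-eventually c p cc
    ...   | m , ret<m , np = m , ≤-trans n≤ret (<⇒≤ ret<m) , ¬T⇒T-not (np ∘ pending⁻)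

    x : ℕ → State
    x zero    = initial (r 0)
    x (suc t) = successor (x t) (w t) (ρ t) (pendingAfter (suc t))

    current-x : ∀ n → current (x n) ≡ r n
    current-x zero    = refl
    current-x (suc n) = refl

    pending-x : ∀ n → pending (x n) ≡ pendingAfter n
    pending-x zero    = sym pendingAfter-0
    pending-x (suc n) = refl

    calls-only : ∀ t → T (callsOnly (w t) (ρ t))
    calls-only t = callsOnly-complete λ p → proj₁ (proj₂ acc t p)

    internal-step : ∀ t → ¬ (∃ λ j → Match A w j t) → Internal (x t) (w t) (x (suc t))
    internal-step t unmatched =
      subst (λ q → T (δ₁ q (w t) (ρ t))) (sym (current-x t)) (proj₂ (transition t) unmatched) ,
      calls-only t ,
      cong (successor (x t) (w t) (ρ t))
           (trans (pending-internal t unmatched) (cong (λ o → opened o (w t) (ρ t)) (sym (pending-x t))))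

    return-step : ∀ j t → Match A w j t → Return (x (suc j)) (x t) (w t) (x (suc t))
    return-step j t m =
      subst (λ q → T (δ₂ (ρ j) q (w t) (ρ t))) (sym (current-x t)) (proj₁ (transition t) j m) ,
      calls-only t ,
      cong (successor (x t) (w t) (ρ t))
           (trans (pending-return m) (cong₂ (λ o o′ → closed o (pendingAt o′ (w j)) (w t))
                                            (sym (pending-x t)) (sym (pending-x j))))

    runs : IsRun A büchi w (encode ∘ x ∘ suc)
    runs = Runs.transitions⇒run A büchi w (encode ∘ x)
      (initial⇒QI (proj₁ (proj₂ (R.run⇒transitions run)) , refl))
      λ t → (λ j m → return⇒δ₂ (return-step j t m)) ,
            (λ unmatched → internal⇒δ₁ (internal-step t unmatched))

    Flag Cond : Fin (suc K) → ℕ → Bool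
    Flag F.zero    n = visited (x n)
    Flag (F.suc s) n = lookup (cleared (x n)) s
    Cond F.zero    n = F (current (x n))
    Cond (F.suc s) n = not (lookup (pending (x n)) s)

    flags-reset : ∀ i → ResetFlags.ResetFlag (accepting ∘ x) (Flag i) (Cond i)
    flags-reset F.zero    = visited-resets w x refl λ _ → refl
    flags-reset (F.suc s) = cleared-resets w x refl (λ _ → refl) s

    conds-infinite : ∀ i → Infinite (Cond i)
    conds-infinite F.zero    = infinite-∘suc⁻ (proj₁ acc)
    conds-infinite (F.suc s) n with infinitely-not-pending s n
    ... | t , n≤t , np = t , n≤t , subst (λ o → T (not (lookup o s))) (sym (pending-x t)) np

    infinitely-accepting : Infinite (accepting ∘ x)
    infinitely-accepting = ResetFlags.flags-complete (accepting ∘ x) Flag Cond flags-reset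
      (λ t set → flags⇒accepting (x t) (set F.zero) (set ∘ F.suc)) conds-infinite

    accepts : IsAccepting A büchi w (encode ∘ x ∘ suc)
    accepts =
      (λ n → let t , n≤t , a = infinite-∘suc infinitely-accepting n in t , n≤t , accepting⇒F a) , λ _ ()

  complete : Accepts A B w → Accepts A büchi w
  complete (_ , run , acc) = _ , runs run acc , accepts run acc

lemma6p4 : (A : Alphabet) (B : GMNWA A) →
    Σ (GMNWA A) (λ B′ → IsBüchi A B′ × (∀ w → Accepts A B′ w ⇔ Accepts A B w))
lemma6p4 A B = Construction.büchi A B , (λ _ → refl) ,
  λ w → mk⇔ (Soundness.sound A B w) (Completeness.complete A B w)
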